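{- Let $b$ be a positive integer and let $\alpha\in S_b^{ -1}\mathbb Z$. There is a unique element $D_b(\alpha)$ of $S_b^{ -1}\mathbb Z$ such that $bD_b(\alpha)-\alpha\in\{0,\dots,b-1\}$. Furthermore, for every integer $a$ satisfying $ab\equiv1\pmod{d(\alpha)}$, $$D_b(\alpha)=a\alpha+\left\lfloor\frac{\alpha-1}{b}-a\alpha\right\rfloor+1.$$
   Context: For $\alpha\in\mathbb Q$, $d(\alpha)$ is its positive reduced denominator. $S_b:=\{k\in\mathbb Z:\gcd(k,b)=1\}$ and $S_b^{ -1}\mathbb Z$ is the ring of rationals $\alpha$ with $d(\alpha)\in S_b$. -}

module Defs where

open import Data.Nat using (ℕ; NonZero)
open import Data.Nat.Coprimality using (Coprime)
open import Data.Integer using (ℤ; +_)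
open import Data.Rational using (ℚ; ↧ₙ_; _/_)

d : ℚ → ℕ
d α = ↧ₙ α

-- α ∈ S_b^{-1} ℤ  iff  gcd(d(α), b) = 1
InSbZ : ℕ → ℚ → Set
InSbZ b α = Coprime (d α) b

ι : ℤ → ℚ
ι z = z / 1

inv : (b : ℕ) → .{{_ : NonZero b}} → ℚ
inv b = (+ 1) / b

{-# OPTIONS --safe #-}
-- Write α = n/q in lowest terms, so gcd(q, b) = 1. If D ∈ S_b⁻¹ℤ and b D − α = k is an integer,
-- then D·(b q) = n + k q is an integer, so the denominator of D divides b q, hence q, and
-- D = t/q with b t = n + k q. Two solutions give b (t − t′) = (k − k′) q, so b ∣ k − k′, whence
-- k = k′ for 0 ≤ k, k′ < b and then t = t′. For existence take a with a b = 1 + m q (Bézout):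
-- every such formula D = a α + ⌊(α − 1)/b − a α⌋ + 1 is a solution, so by uniqueness they all
-- agree with D_b(α).
module Submission where

open import Defs
open import Data.Nat using (ℕ; NonZero; _<_)
open import Data.Integer using (ℤ; +_) renaming (_-_ to _-ℤ_; _*_ to _*ℤ_)
open import Data.Integer.Divisibility using (_∣_)
open import Data.Rational using (ℚ; _+_; _*_; _-_; 1ℚ; floor)
open import Data.Product using (Σ; _×_)
open import Relation.Binary.PropositionalEquality using (_≡_)

open import Data.List using (_∷_; [])
open import Data.Product using (_,_; proj₁; proj₂)
open import Relation.Binary.PropositionalEquality
  using (refl; sym; trans; cong; cong₂; subst; module ≡-Reasoning)
import Data.Nat as ℕ
import Data.Nat.Properties as ℕ
import Data.Nat.DivMod as ℕ
import Data.Nat.Divisibility as ℕ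
import Data.Nat.Coprimality as ℕ
open import Data.Nat.GCD using (module Bézout)
import Data.Integer as ℤ
import Data.Integer.Properties as ℤ
import Data.Integer.DivMod as ℤ
import Data.Integer.Coprimality as ℤ
open import Data.Integer.Divisibility.Signed using (divides; ∣ᵤ⇒∣; ∣⇒∣ᵤ) renaming (_∣_ to _∣ₛ_)
open import Data.Integer.Tactic.RingSolver using (solve)
open import Data.Rational using (mkℚ; ↥_; ↧_; ↧ₙ_; toℚᵘ; -_)
import Data.Rational.Properties as ℚ
open import Data.Rational.Solver using (module +-*-Solver)
open +-*-Solver using (_:+_; _:*_; _:-_; :-_; _:=_; con) renaming (solve to solveℚ)
import Data.Rational.Unnormalised as ℚᵘ
import Data.Rational.Unnormalised.Properties as ℚᵘ

toℚᵘ-ι : ∀ z → toℚᵘ (ι z) ℚᵘ.≃ ℚᵘ.mkℚᵘ z 0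
toℚᵘ-ι z = ℚ.toℚᵘ-fromℚᵘ (ℚᵘ.mkℚᵘ z 0)

ι-+ : ∀ x y → ι (x ℤ.+ y) ≡ ι x + ι y
ι-+ x y = ℚ.toℚᵘ-injective (begin
  toℚᵘ (ι (x ℤ.+ y))               ≈⟨ toℚᵘ-ι (x ℤ.+ y) ⟩
  ℚᵘ.mkℚᵘ (x ℤ.+ y) 0              ≈⟨ ℚᵘ.*≡* cross ⟩
  ℚᵘ.mkℚᵘ x 0 ℚᵘ.+ ℚᵘ.mkℚᵘ y 0     ≈⟨ ℚᵘ.+-cong (toℚᵘ-ι x) (toℚᵘ-ι y) ⟨
  toℚᵘ (ι x) ℚᵘ.+ toℚᵘ (ι y)       ≈⟨ ℚ.toℚᵘ-homo-+ (ι x) (ι y) ⟨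
  toℚᵘ (ι x + ι y)                 ∎)
  where
  open ℚᵘ.≃-Reasoning
  cross : (x ℤ.+ y) ℤ.* + 1 ≡ (x ℤ.* + 1 ℤ.+ y ℤ.* + 1) ℤ.* + 1
  cross = solve (x ∷ y ∷ [])

ι-* : ∀ x y → ι (x ℤ.* y) ≡ ι x * ι y
ι-* x y = ℚ.toℚᵘ-injective (begin
  toℚᵘ (ι (x ℤ.* y))               ≈⟨ toℚᵘ-ι (x ℤ.* y) ⟩
  ℚᵘ.mkℚᵘ (x ℤ.* y) 0              ≈⟨ ℚᵘ.*-cong (toℚᵘ-ι x) (toℚᵘ-ι y) ⟨
  toℚᵘ (ι x) ℚᵘ.* toℚᵘ (ι y)       ≈⟨ ℚ.toℚᵘ-homo-* (ι x) (ι y) ⟨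
  toℚᵘ (ι x * ι y)                 ∎)
  where open ℚᵘ.≃-Reasoning

ι-neg : ∀ x → ι (ℤ.- x) ≡ - ι x
ι-neg x = ℚ.toℚᵘ-injective (begin
  toℚᵘ (ι (ℤ.- x))          ≈⟨ toℚᵘ-ι (ℤ.- x) ⟩
  ℚᵘ.mkℚᵘ (ℤ.- x) 0         ≈⟨ ℚᵘ.-‿cong (toℚᵘ-ι x) ⟨
  ℚᵘ.- toℚᵘ (ι x)           ≈⟨ ℚ.toℚᵘ-homo‿- (ι x) ⟨
  toℚᵘ (- ι x)              ∎)
  where open ℚᵘ.≃-Reasoning

ι-injective : ∀ {x y} → ι x ≡ ι y → x ≡ y
ι-injective {x} {y} e
  with ℚᵘ.≃-trans (ℚᵘ.≃-sym (toℚᵘ-ι x)) (ℚᵘ.≃-trans (ℚ.toℚᵘ-cong e) (toℚᵘ-ι y))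
... | ℚᵘ.*≡* x*1≡y*1 = ℤ.*-cancelʳ-≡ x y (+ 1) x*1≡y*1

p*↧p≡↥p : ∀ p → p * ι (↧ p) ≡ ι (↥ p)
p*↧p≡↥p p@(mkℚ n d-1 _) = ℚ.toℚᵘ-injective (begin
  toℚᵘ (p * ι (↧ p))                      ≈⟨ ℚ.toℚᵘ-homo-* p (ι (↧ p)) ⟩
  ℚᵘ.mkℚᵘ n d-1 ℚᵘ.* toℚᵘ (ι (↧ p))       ≈⟨ ℚᵘ.*-congˡ {ℚᵘ.mkℚᵘ n d-1} (toℚᵘ-ι (↧ p)) ⟩
  ℚᵘ.mkℚᵘ n d-1 ℚᵘ.* ℚᵘ.mkℚᵘ (↧ p) 0      ≈⟨ ℚᵘ.*≡* cross ⟩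
  ℚᵘ.mkℚᵘ n 0                              ≈⟨ toℚᵘ-ι n ⟨
  toℚᵘ (ι n)                               ∎)
  where
  open ℚᵘ.≃-Reasoning
  cross : (n ℤ.* ↧ p) ℤ.* + 1 ≡ n ℤ.* + (ℕ.suc d-1 ℕ.* 1)
  cross = trans (ℤ.*-identityʳ _) (cong (λ e → n ℤ.* + e) (sym (ℕ.*-identityʳ (ℕ.suc d-1))))

inv*ι≡1 : ∀ c .{{_ : NonZero c}} → inv c * ι (+ c) ≡ 1ℚ
inv*ι≡1 c@(ℕ.suc c-1) = ℚ.toℚᵘ-injective (begin
  toℚᵘ (inv c * ι (+ c))
    ≈⟨ ℚ.toℚᵘ-homo-* (inv c) (ι (+ c)) ⟩
  toℚᵘ (inv c) ℚᵘ.* toℚᵘ (ι (+ c))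
    ≈⟨ ℚᵘ.*-cong (ℚ.toℚᵘ-fromℚᵘ (ℚᵘ.mkℚᵘ (+ 1) c-1)) (toℚᵘ-ι (+ c)) ⟩
  ℚᵘ.mkℚᵘ (+ 1) c-1 ℚᵘ.* ℚᵘ.mkℚᵘ (+ c) 0
    ≈⟨ ℚᵘ.*≡* cross ⟩
  ℚᵘ.1ℚᵘ ∎)
  where
  open ℚᵘ.≃-Reasoning
  cross : (+ 1 ℤ.* + c) ℤ.* + 1 ≡ + 1 ℤ.* + (c ℕ.* 1)
  cross = cong (λ e → + e) (trans (ℕ.*-identityʳ _) (cong (1 ℕ.*_) (sym (ℕ.*-identityʳ c))))

*ι-cancelʳ : ∀ c .{{_ : NonZero c}} {x y} → x * ι (+ c) ≡ y * ι (+ c) → x ≡ y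
*ι-cancelʳ c {x} {y} e = begin
  x                        ≡⟨ z≡z*c*c⁻¹ x ⟩
  x * ι (+ c) * inv c      ≡⟨ cong (_* inv c) e ⟩
  y * ι (+ c) * inv c      ≡⟨ z≡z*c*c⁻¹ y ⟨
  y                        ∎
  where
  open ≡-Reasoning
  z≡z*c*c⁻¹ : ∀ z → z ≡ z * ι (+ c) * inv c
  z≡z*c*c⁻¹ z = begin
    z                          ≡⟨ ℚ.*-identityʳ z ⟨
    z * 1ℚ                     ≡⟨ cong (z *_) (inv*ι≡1 c) ⟨
    z * (inv c * ι (+ c))      ≡⟨ solveℚ 3 (λ z i c → z :* (i :* c) := z :* c :* i)
                                              refl z (inv c) (ι (+ c)) ⟩
    z * ι (+ c) * inv c        ∎

↥*≡*↧ : ∀ X c {y} → X * ι (+ c) ≡ ι y → ↥ X ℤ.* + c ≡ y ℤ.* ↧ X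
↥*≡*↧ X c {y} e = ι-injective (begin
  ι (↥ X ℤ.* + c)             ≡⟨ ι-* (↥ X) (+ c) ⟩
  ι (↥ X) * ι (+ c)           ≡⟨ cong (_* ι (+ c)) (p*↧p≡↥p X) ⟨
  X * ι (↧ X) * ι (+ c)       ≡⟨ solveℚ 3 (λ x d c → x :* d :* c := x :* c :* d)
                                           refl X (ι (↧ X)) (ι (+ c)) ⟩
  X * ι (+ c) * ι (↧ X)       ≡⟨ cong (_* ι (↧ X)) e ⟩
  ι y * ι (↧ X)               ≡⟨ ι-* y (↧ X) ⟨
  ι (y ℤ.* ↧ X)               ∎)
  where open ≡-Reasoning

*ι≡ι⇒↧∣ : ∀ X c {y} → X * ι (+ c) ≡ ι y → ↧ₙ X ℕ.∣ c
*ι≡ι⇒↧∣ X@(mkℚ _ _ coprime) c {y} e =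
  ℤ.coprime-divisor (↧ X) (↥ X) (+ c) (ℕ.sym (ℕ.recompute coprime))
    (∣⇒∣ᵤ {↧ X} (divides y (↥*≡*↧ X c {y} e)))

↧∣⇒*ι≡ι : ∀ X c → ↧ₙ X ℕ.∣ c → Σ ℤ λ y → X * ι (+ c) ≡ ι y
↧∣⇒*ι≡ι X _ (ℕ.divides e refl) = ↥ X ℤ.* + e , (begin
  X * ι (+ (e ℕ.* ↧ₙ X))        ≡⟨ cong (λ z → X * ι z) (ℤ.pos-* e (↧ₙ X)) ⟩
  X * ι (+ e ℤ.* ↧ X)           ≡⟨ cong (X *_) (ι-* (+ e) (↧ X)) ⟩
  X * (ι (+ e) * ι (↧ X))       ≡⟨ solveℚ 3 (λ x e d → x :* (e :* d) := x :* d :* e)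
                                             refl X (ι (+ e)) (ι (↧ X)) ⟩
  X * ι (↧ X) * ι (+ e)         ≡⟨ cong (_* ι (+ e)) (p*↧p≡↥p X) ⟩
  ι (↥ X) * ι (+ e)             ≡⟨ ι-* (↥ X) (+ e) ⟨
  ι (↥ X ℤ.* + e)               ∎)
  where open ≡-Reasoning

[a/d]*d≤a : ∀ a d .{{_ : NonZero d}} → a ℤ./ + d ℤ.* + d ℤ.≤ a
[a/d]*d≤a a d = subst (a ℤ./ + d ℤ.* + d ℤ.≤_) (sym (ℤ.a≡a%n+[a/n]*n a (+ d)))
  (ℤ.i≤j+i (a ℤ./ + d ℤ.* + d) (+ (a ℤ.% + d)))

a<suc[a/d]*d : ∀ a d .{{_ : NonZero d}} → a ℤ.< ℤ.suc (a ℤ./ + d) ℤ.* + d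
a<suc[a/d]*d a d = begin-strict
  a                                    ≡⟨ ℤ.a≡a%n+[a/n]*n a (+ d) ⟩
  + (a ℤ.% + d) ℤ.+ a ℤ./ + d ℤ.* + d  <⟨ ℤ.+-monoˡ-< (a ℤ./ + d ℤ.* + d) (ℤ.+<+ (ℤ.n%d<d a (+ d))) ⟩
  + d ℤ.+ a ℤ./ + d ℤ.* + d            ≡⟨ ℤ.suc-* (a ℤ./ + d) (+ d) ⟨
  ℤ.suc (a ℤ./ + d) ℤ.* + d            ∎
  where open ℤ.≤-Reasoning

/-cross-≤ : ∀ a b c d .{{_ : NonZero c}} .{{_ : NonZero d}} →
  a ℤ.* + c ≡ b ℤ.* + d → a ℤ./ + d ℤ.≤ b ℤ./ + c
/-cross-≤ a b c@(ℕ.suc _) d@(ℕ.suc _) ac≡bd =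
  subst (f ℤ.≤_) (ℤ.pred-suc g) (ℤ.i<j⇒i≤pred[j]
    (ℤ.*-cancelʳ-<-nonNeg {f} {ℤ.suc g} (+ c ℤ.* + d) (begin-strict
    f ℤ.* (+ c ℤ.* + d)          ≡⟨ cong (f ℤ.*_) (ℤ.*-comm (+ c) (+ d)) ⟩
    f ℤ.* (+ d ℤ.* + c)          ≡⟨ ℤ.*-assoc f (+ d) (+ c) ⟨
    f ℤ.* + d ℤ.* + c            ≤⟨ ℤ.*-monoʳ-≤-nonNeg (+ c) ([a/d]*d≤a a d) ⟩
    a ℤ.* + c                    ≡⟨ ac≡bd ⟩
    b ℤ.* + d                    <⟨ ℤ.*-monoʳ-<-pos (+ d) (a<suc[a/d]*d b c) ⟩
    ℤ.suc g ℤ.* + c ℤ.* + d      ≡⟨ ℤ.*-assoc (ℤ.suc g) (+ c) (+ d) ⟩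
    ℤ.suc g ℤ.* (+ c ℤ.* + d)    ∎)))
  where
  open ℤ.≤-Reasoning
  f g : ℤ
  f = a ℤ./ + d
  g = b ℤ./ + c

/-cross : ∀ a b c d .{{_ : NonZero c}} .{{_ : NonZero d}} →
  a ℤ.* + c ≡ b ℤ.* + d → a ℤ./ + d ≡ b ℤ./ + c
/-cross a b c d ac≡bd = ℤ.≤-antisym (/-cross-≤ a b c d ac≡bd) (/-cross-≤ b a d c (sym ac≡bd))

*ι≡ι⇒floor≡/ : ∀ X c .{{_ : NonZero c}} {y} → X * ι (+ c) ≡ ι y → floor X ≡ y ℤ./ + c
*ι≡ι⇒floor≡/ X@(mkℚ _ _ _) c {y} e = /-cross (↥ X) y c (↧ₙ X) (↥*≡*↧ X c {y} e)

pos-Bézout : ∀ u m v n → 1 ℕ.+ u ℕ.* m ≡ v ℕ.* n → + 1 ℤ.+ + u ℤ.* + m ≡ + v ℤ.* + n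
pos-Bézout u m v n e =
  trans (cong (λ z → + 1 ℤ.+ z) (sym (ℤ.pos-* u m))) (trans (cong +_ e) (ℤ.pos-* v n))

coprime⇒invertible : ∀ {q b} → ℕ.Coprime q b → Σ ℤ λ a → + q ∣ a ℤ.* + b ℤ.- + 1
coprime⇒invertible {q} {b} q⊥b with ℕ.coprime-Bézout q⊥b
... | Bézout.+- x y 1+yb≡xq =
  ℤ.- + y , ∣⇒∣ᵤ (divides (ℤ.- + x) (negated (+ x) (+ y) (+ b) (+ q) (pos-Bézout y b x q 1+yb≡xq)))
  where
  negated : ∀ x y b q → + 1 ℤ.+ y ℤ.* b ≡ x ℤ.* q → ℤ.- y ℤ.* b ℤ.- + 1 ≡ ℤ.- x ℤ.* q
  negated x y b q e = begin
    ℤ.- y ℤ.* b ℤ.- + 1         ≡⟨ solve (y ∷ b ∷ []) ⟩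
    ℤ.- (+ 1 ℤ.+ y ℤ.* b)       ≡⟨ cong ℤ.-_ e ⟩
    ℤ.- (x ℤ.* q)               ≡⟨ solve (x ∷ q ∷ []) ⟩
    ℤ.- x ℤ.* q                 ∎
    where open ≡-Reasoning
... | Bézout.-+ x y 1+xq≡yb =
  + y , ∣⇒∣ᵤ (divides (+ x) (shifted (+ x) (+ y) (+ b) (+ q) (pos-Bézout x q y b 1+xq≡yb)))
  where
  shifted : ∀ x y b q → + 1 ℤ.+ x ℤ.* q ≡ y ℤ.* b → y ℤ.* b ℤ.- + 1 ≡ x ℤ.* q
  shifted x y b q e = begin
    y ℤ.* b ℤ.- + 1             ≡⟨ cong (ℤ._- + 1) e ⟨
    + 1 ℤ.+ x ℤ.* q ℤ.- + 1     ≡⟨ solve (x ∷ q ∷ []) ⟩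
    x ℤ.* q                     ∎
    where open ≡-Reasoning

∣[k-k′]⇒k≡k′ : ∀ {b k k′} .{{_ : NonZero b}} → k < b → k′ < b → + b ∣ + k ℤ.- + k′ → k ≡ k′
∣[k-k′]⇒k≡k′ {b} {k} {k′} k<b k′<b b∣k-k′ =
  ℤ.+-injective (ℤ.i-j≡0⇒i≡j (+ k) (+ k′) (ℤ.∣i∣≡0⇒i≡0 ∣k-k′∣≡0))
  where
  ∣k-k′∣<b : ℤ.∣ + k ℤ.- + k′ ∣ < b
  ∣k-k′∣<b = ℕ.≤-<-trans
    (subst (ℕ._≤ k ℕ.⊔ k′) (cong ℤ.∣_∣ (sym (ℤ.m-n≡m⊖n k k′))) (ℤ.∣m⊝n∣≤m⊔n k k′))
    (ℕ.⊔-lub k<b k′<b)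
  ∣k-k′∣≡0 : ℤ.∣ + k ℤ.- + k′ ∣ ≡ 0
  ∣k-k′∣≡0 = trans (sym (ℕ.m<n⇒m%n≡m ∣k-k′∣<b)) (ℕ.n∣m⇒m%n≡0 _ b b∣k-k′)

DigitCondition : ℕ → ℚ → ℚ → Set
DigitCondition b α D = Σ ℕ λ k → k < b × ι (+ b) * D - α ≡ ι (+ k)

IsD : ℕ → ℚ → ℚ → Set
IsD b α D = InSbZ b D × DigitCondition b α D

Numerator : ℕ → ℚ → ℚ → ℕ → ℤ → Set
Numerator b α D k t = D * ι (+ d α) ≡ ι t × + b ℤ.* t ≡ ↥ α ℤ.+ + k ℤ.* + d α

solution⇒numerator : ∀ b α D k → InSbZ b D → ι (+ b) * D - α ≡ ι (+ k) → Σ ℤ (Numerator b α D k)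
solution⇒numerator b α D k D∈S bD-α≡k = t , Dq≡t , ι-injective (begin
  ι (+ b ℤ.* t)               ≡⟨ ι-* (+ b) t ⟩
  ι (+ b) * ι t               ≡⟨ cong (ι (+ b) *_) Dq≡t ⟨
  ι (+ b) * (D * ι (+ q))     ≡⟨ bDq≡n+kq ⟩
  ι (↥ α ℤ.+ + k ℤ.* + q)     ∎)
  where
  open ≡-Reasoning
  q : ℕ
  q = d α
  bDq≡n+kq : ι (+ b) * (D * ι (+ q)) ≡ ι (↥ α ℤ.+ + k ℤ.* + q)
  bDq≡n+kq = begin
    ι (+ b) * (D * ι (+ q))
      ≡⟨ solveℚ 4 (λ b D α q → b :* (D :* q) := α :* q :+ (b :* D :- α) :* q) refl (ι (+ b)) D α (ι (+ q)) ⟩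
    α * ι (+ q) + (ι (+ b) * D - α) * ι (+ q)
      ≡⟨ cong₂ (λ u v → u + v * ι (+ q)) (p*↧p≡↥p α) bD-α≡k ⟩
    ι (↥ α) + ι (+ k) * ι (+ q)
      ≡⟨ cong (λ z → ι (↥ α) + z) (ι-* (+ k) (+ q)) ⟨
    ι (↥ α) + ι (+ k ℤ.* + q)
      ≡⟨ ι-+ (↥ α) (+ k ℤ.* + q) ⟨
    ι (↥ α ℤ.+ + k ℤ.* + q) ∎
  Dbq≡bDq : D * ι (+ (b ℕ.* q)) ≡ ι (+ b) * (D * ι (+ q))
  Dbq≡bDq = begin
    D * ι (+ (b ℕ.* q))           ≡⟨ cong (λ z → D * ι z) (ℤ.pos-* b q) ⟩
    D * ι (+ b ℤ.* + q)           ≡⟨ cong (D *_) (ι-* (+ b) (+ q)) ⟩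
    D * (ι (+ b) * ι (+ q))       ≡⟨ solveℚ 3 (λ D b q → D :* (b :* q) := b :* (D :* q))
                                               refl D (ι (+ b)) (ι (+ q)) ⟩
    ι (+ b) * (D * ι (+ q))       ∎
  ↧D∣q : ↧ₙ D ℕ.∣ q
  ↧D∣q = ℕ.coprime-divisor D∈S (*ι≡ι⇒↧∣ D (b ℕ.* q) {↥ α ℤ.+ + k ℤ.* + q} (trans Dbq≡bDq bDq≡n+kq))
  t : ℤ
  t = proj₁ (↧∣⇒*ι≡ι D q ↧D∣q)
  Dq≡t : D * ι (+ q) ≡ ι t
  Dq≡t = proj₂ (↧∣⇒*ι≡ι D q ↧D∣q)

numerator⇒solution : ∀ b α D k {t} → Numerator b α D k t → ι (+ b) * D - α ≡ ι (+ k)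
numerator⇒solution b α D k {t} (Dq≡t , bt≡n+kq) = *ι-cancelʳ q (begin
  (ι (+ b) * D - α) * ι (+ q)
    ≡⟨ solveℚ 4 (λ b D α q → (b :* D :- α) :* q := b :* (D :* q) :- α :* q) refl (ι (+ b)) D α (ι (+ q)) ⟩
  ι (+ b) * (D * ι (+ q)) - α * ι (+ q)
    ≡⟨ cong₂ (λ u v → ι (+ b) * u - v) Dq≡t (p*↧p≡↥p α) ⟩
  ι (+ b) * ι t - ι (↥ α)
    ≡⟨ cong (_- ι (↥ α)) (trans (cong ι (sym bt≡n+kq)) (ι-* (+ b) t)) ⟨
  ι (↥ α ℤ.+ + k ℤ.* + q) - ι (↥ α)
    ≡⟨ cong (_- ι (↥ α)) (ι-+ (↥ α) (+ k ℤ.* + q)) ⟩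
  ι (↥ α) + ι (+ k ℤ.* + q) - ι (↥ α)
    ≡⟨ solveℚ 2 (λ n m → n :+ m :- n := m) refl (ι (↥ α)) (ι (+ k ℤ.* + q)) ⟩
  ι (+ k ℤ.* + q)
    ≡⟨ ι-* (+ k) (+ q) ⟩
  ι (+ k) * ι (+ q) ∎)
  where
  open ≡-Reasoning
  q : ℕ
  q = d α

*ι≡ι⇒InSbZ : ∀ b α D {t} → InSbZ b α → D * ι (+ d α) ≡ ι t → InSbZ b D
*ι≡ι⇒InSbZ b α D {t} α∈S Dq≡t (i∣↧D , i∣b) = α∈S (ℕ.∣-trans i∣↧D (*ι≡ι⇒↧∣ D (d α) {t} Dq≡t) , i∣b)

numerator-unique : ∀ {b q} .{{_ : NonZero b}} → ℕ.Coprime q b → ∀ {n t t′ k k′} → k < b → k′ < b →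
  + b ℤ.* t ≡ n ℤ.+ + k ℤ.* + q → + b ℤ.* t′ ≡ n ℤ.+ + k′ ℤ.* + q → t ≡ t′
numerator-unique {b} {q} q⊥b {n} {t} {t′} {k} {k′} k<b k′<b bt≡n+kq bt′≡n+k′q =
  ℤ.*-cancelˡ-≡ (+ b) t t′ (trans bt≡n+kq (trans (cong (λ k → n ℤ.+ + k ℤ.* + q) k≡k′) (sym bt′≡n+k′q)))
  where
  difference : ∀ b t t′ n q K K′ → b ℤ.* t ≡ n ℤ.+ K ℤ.* q → b ℤ.* t′ ≡ n ℤ.+ K′ ℤ.* q →
    q ℤ.* (K ℤ.- K′) ≡ (t ℤ.- t′) ℤ.* b
  difference b t t′ n q K K′ e e′ = begin
    q ℤ.* (K ℤ.- K′)                          ≡⟨ solve (n ∷ q ∷ K ∷ K′ ∷ []) ⟩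
    (n ℤ.+ K ℤ.* q) ℤ.- (n ℤ.+ K′ ℤ.* q)      ≡⟨ cong₂ ℤ._-_ e e′ ⟨
    b ℤ.* t ℤ.- b ℤ.* t′                      ≡⟨ solve (b ∷ t ∷ t′ ∷ []) ⟩
    (t ℤ.- t′) ℤ.* b                          ∎
    where open ≡-Reasoning
  k≡k′ : k ≡ k′
  k≡k′ = ∣[k-k′]⇒k≡k′ k<b k′<b (ℤ.coprime-divisor (+ b) (+ q) (+ k ℤ.- + k′) (ℕ.sym q⊥b)
    (∣⇒∣ᵤ (divides (t ℤ.- t′) (difference (+ b) t t′ n (+ q) (+ k) (+ k′) bt≡n+kq bt′≡n+k′q))))

IsD-unique : ∀ b .{{_ : NonZero b}} α {D D′} → InSbZ b α → IsD b α D → IsD b α D′ → D ≡ D′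
IsD-unique b α {D} {D′} α∈S (D∈S , k , k<b , bD-α≡k) (D′∈S , k′ , k′<b , bD′-α≡k′) =
  same-numerator (solution⇒numerator b α D k D∈S bD-α≡k) (solution⇒numerator b α D′ k′ D′∈S bD′-α≡k′)
  where
  same-numerator : Σ ℤ (Numerator b α D k) → Σ ℤ (Numerator b α D′ k′) → D ≡ D′
  same-numerator (t , Dq≡t , bt≡n+kq) (t′ , D′q≡t′ , bt′≡n+k′q) =
    *ι-cancelʳ (d α) {D} {D′} (trans Dq≡t (trans (cong ι t≡t′) (sym D′q≡t′)))
    where
    t≡t′ : t ≡ t′
    t≡t′ = numerator-unique {b} {d α} α∈S {↥ α} {t} {t′} k<b k′<b bt≡n+kq bt′≡n+k′q

Dformula : (b : ℕ) → .{{_ : NonZero b}} → ℚ → ℤ → ℚ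
Dformula b α a = ι a * α + ι (floor ((α - 1ℚ) * inv b - ι a * α)) + 1ℚ

floor-argument*b : ∀ b .{{_ : NonZero b}} α a {m} → a ℤ.* + b ℤ.- + 1 ≡ m ℤ.* + d α →
  ((α - 1ℚ) * inv b - ι a * α) * ι (+ b) ≡ ι (ℤ.- (+ 1 ℤ.+ m ℤ.* ↥ α))
floor-argument*b b α a {m} ab-1≡mq = begin
  ((α - 1ℚ) * inv b - ι a * α) * ι (+ b)
    ≡⟨ solveℚ 4 (λ α i a b → ((α :- con 1ℚ) :* i :- a :* α) :* b
                           := (α :- con 1ℚ) :* (i :* b) :- (a :* b :- con 1ℚ) :* α :- α)
         refl α (inv b) (ι a) (ι (+ b)) ⟩
  (α - 1ℚ) * (inv b * ι (+ b)) - (ι a * ι (+ b) - 1ℚ) * α - α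
    ≡⟨ cong₂ (λ u v → (α - 1ℚ) * u - v * α - α) (inv*ι≡1 b) ιab-1≡ιmq ⟩
  (α - 1ℚ) * 1ℚ - ι m * ι (+ q) * α - α
    ≡⟨ solveℚ 3 (λ α m q → (α :- con 1ℚ) :* con 1ℚ :- m :* q :* α :- α := :- (con 1ℚ :+ m :* (α :* q)))
         refl α (ι m) (ι (+ q)) ⟩
  - (1ℚ + ι m * (α * ι (+ q)))
    ≡⟨ cong (λ z → - (1ℚ + ι m * z)) (p*↧p≡↥p α) ⟩
  - (1ℚ + ι m * ι (↥ α))
    ≡⟨ trans (ι-neg (+ 1 ℤ.+ m ℤ.* ↥ α))
         (cong -_ (trans (ι-+ (+ 1) (m ℤ.* ↥ α)) (cong (λ z → 1ℚ + z) (ι-* m (↥ α))))) ⟨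
  ι (ℤ.- (+ 1 ℤ.+ m ℤ.* ↥ α)) ∎
  where
  open ≡-Reasoning
  q : ℕ
  q = d α
  ιab-1≡ιmq : ι a * ι (+ b) - 1ℚ ≡ ι m * ι (+ q)
  ιab-1≡ιmq = begin
    ι a * ι (+ b) - 1ℚ               ≡⟨ cong₂ _+_ (ι-* a (+ b)) (ι-neg (+ 1)) ⟨
    ι (a ℤ.* + b) + ι (ℤ.- + 1)      ≡⟨ ι-+ (a ℤ.* + b) (ℤ.- + 1) ⟨
    ι (a ℤ.* + b ℤ.- + 1)            ≡⟨ cong ι ab-1≡mq ⟩
    ι (m ℤ.* + q)                    ≡⟨ ι-* m (+ q) ⟩
    ι m * ι (+ q)                    ∎

[aα+f+1]*d≡ι : ∀ α a f →
  (ι a * α + ι f + 1ℚ) * ι (+ d α) ≡ ι (a ℤ.* ↥ α ℤ.+ (f ℤ.+ + 1) ℤ.* + d α)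
[aα+f+1]*d≡ι α a f = begin
  (ι a * α + ι f + 1ℚ) * ι (+ q)
    ≡⟨ solveℚ 4 (λ a α f q → (a :* α :+ f :+ con 1ℚ) :* q := a :* (α :* q) :+ (f :+ con 1ℚ) :* q)
         refl (ι a) α (ι f) (ι (+ q)) ⟩
  ι a * (α * ι (+ q)) + (ι f + 1ℚ) * ι (+ q)
    ≡⟨ cong (λ z → ι a * z + (ι f + 1ℚ) * ι (+ q)) (p*↧p≡↥p α) ⟩
  ι a * ι (↥ α) + (ι f + 1ℚ) * ι (+ q)
    ≡⟨ cong₂ _+_ (ι-* a (↥ α)) (trans (ι-* (f ℤ.+ + 1) (+ q)) (cong (_* ι (+ q)) (ι-+ f (+ 1)))) ⟨
  ι (a ℤ.* ↥ α) + ι ((f ℤ.+ + 1) ℤ.* + q)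
    ≡⟨ ι-+ (a ℤ.* ↥ α) ((f ℤ.+ + 1) ℤ.* + q) ⟨
  ι (a ℤ.* ↥ α ℤ.+ (f ℤ.+ + 1) ℤ.* + q) ∎
  where
  open ≡-Reasoning
  q : ℕ
  q = d α

numerator-identity : ∀ a b n m q f r k → a ℤ.* b ℤ.- + 1 ≡ m ℤ.* q →
  ℤ.- (+ 1 ℤ.+ m ℤ.* n) ≡ r ℤ.+ f ℤ.* b → k ≡ b ℤ.- (+ 1 ℤ.+ r) →
  b ℤ.* (a ℤ.* n ℤ.+ (f ℤ.+ + 1) ℤ.* q) ≡ n ℤ.+ k ℤ.* q
numerator-identity a b n m q f r k ab-1≡mq y≡r+fb k≡b-[1+r] = begin
  b ℤ.* (a ℤ.* n ℤ.+ (f ℤ.+ + 1) ℤ.* q)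
    ≡⟨ solve (a ∷ b ∷ n ∷ q ∷ f ∷ []) ⟩
  (a ℤ.* b ℤ.- + 1) ℤ.* n ℤ.+ n ℤ.+ (f ℤ.* b ℤ.+ b) ℤ.* q
    ≡⟨ cong (λ z → z ℤ.* n ℤ.+ n ℤ.+ (f ℤ.* b ℤ.+ b) ℤ.* q) ab-1≡mq ⟩
  m ℤ.* q ℤ.* n ℤ.+ n ℤ.+ (f ℤ.* b ℤ.+ b) ℤ.* q
    ≡⟨ solve (b ∷ n ∷ m ∷ q ∷ f ∷ []) ⟩
  n ℤ.+ (b ℤ.- (+ 1 ℤ.+ (ℤ.- (+ 1 ℤ.+ m ℤ.* n) ℤ.- f ℤ.* b))) ℤ.* q
    ≡⟨ cong (λ z → n ℤ.+ (b ℤ.- (+ 1 ℤ.+ (z ℤ.- f ℤ.* b))) ℤ.* q) y≡r+fb ⟩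
  n ℤ.+ (b ℤ.- (+ 1 ℤ.+ (r ℤ.+ f ℤ.* b ℤ.- f ℤ.* b))) ℤ.* q
    ≡⟨ solve (b ∷ n ∷ q ∷ f ∷ r ∷ []) ⟩
  n ℤ.+ (b ℤ.- (+ 1 ℤ.+ r)) ℤ.* q
    ≡⟨ cong (λ z → n ℤ.+ z ℤ.* q) k≡b-[1+r] ⟨
  n ℤ.+ k ℤ.* q ∎
  where open ≡-Reasoning

-- b X is the integer y = -(1 + m n), so floor X is the quotient of y by b and, with r the
-- remainder, b D - α = b - 1 - r.
Dformula-IsD : ∀ b .{{_ : NonZero b}} α a → InSbZ b α → + d α ∣ a ℤ.* + b ℤ.- + 1 →
  IsD b α (Dformula b α a)
Dformula-IsD b α a α∈S q∣ab-1 =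
  *ι≡ι⇒InSbZ b α D {t} α∈S Dq≡t , k , k<b , numerator⇒solution b α D k {t} (Dq≡t , bt≡n+kq)
  where
  q∣ₛab-1 : + d α ∣ₛ a ℤ.* + b ℤ.- + 1
  q∣ₛab-1 = ∣ᵤ⇒∣ q∣ab-1
  m : ℤ
  m = _∣ₛ_.quotient q∣ₛab-1
  ab-1≡mq : a ℤ.* + b ℤ.- + 1 ≡ m ℤ.* + d α
  ab-1≡mq = _∣ₛ_.equality q∣ₛab-1

  X : ℚ
  X = (α - 1ℚ) * inv b - ι a * α
  y f : ℤ
  y = ℤ.- (+ 1 ℤ.+ m ℤ.* ↥ α)
  f = floor X
  r : ℕ
  r = y ℤ.% + b
  y≡r+fb : y ≡ + r ℤ.+ f ℤ.* + b
  y≡r+fb = trans (ℤ.a≡a%n+[a/n]*n y (+ b))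
    (cong (λ g → + r ℤ.+ g ℤ.* + b) (sym (*ι≡ι⇒floor≡/ X b {y} (floor-argument*b b α a {m} ab-1≡mq))))

  k : ℕ
  k = b ℕ.∸ ℕ.suc r
  k<b : k < b
  k<b = ℕ.∸-monoʳ-< (ℕ.s≤s ℕ.z≤n) (ℤ.n%d<d y (+ b))
  k≡b-[1+r] : + k ≡ + b ℤ.- (+ 1 ℤ.+ + r)
  k≡b-[1+r] = trans (sym (ℤ.⊖-≥ (ℤ.n%d<d y (+ b)))) (sym (ℤ.m-n≡m⊖n b (ℕ.suc r)))

  D : ℚ
  D = Dformula b α a
  t : ℤ
  t = a ℤ.* ↥ α ℤ.+ (f ℤ.+ + 1) ℤ.* + d α
  Dq≡t : D * ι (+ d α) ≡ ι t
  Dq≡t = [aα+f+1]*d≡ι α a f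
  bt≡n+kq : + b ℤ.* t ≡ ↥ α ℤ.+ + k ℤ.* + d α
  bt≡n+kq = numerator-identity a (+ b) (↥ α) m (+ d α) f (+ r) (+ k) ab-1≡mq y≡r+fb k≡b-[1+r]

mainTheorem3 : (b : ℕ) → .{{_ : NonZero b}} → (α : ℚ) → InSbZ b α →
  Σ ℚ (λ D →
    (InSbZ b D × Σ ℕ (λ k → k < b × ι (+ b) * D - α ≡ ι (+ k)))
    × ((D′ : ℚ) → InSbZ b D′ → Σ ℕ (λ k → k < b × ι (+ b) * D′ - α ≡ ι (+ k)) → D′ ≡ D)
    × ((a : ℤ) → (+ d α) ∣ (a *ℤ (+ b) -ℤ (+ 1)) →
        D ≡ ι a * α + ι (floor ((α - 1ℚ) * inv b - ι a * α)) + 1ℚ))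
mainTheorem3 b α α∈S =
  D , D-isD ,
  (λ D′ D′∈S D′-digit → IsD-unique b α α∈S (D′∈S , D′-digit) D-isD) ,
  (λ a q∣ab-1 → IsD-unique b α α∈S D-isD (Dformula-IsD b α a α∈S q∣ab-1))
  where
  a₀ : ℤ
  a₀ = proj₁ (coprime⇒invertible α∈S)
  D : ℚ
  D = Dformula b α a₀
  D-isD : IsD b α D
  D-isD = Dformula-IsD b α a₀ α∈S (proj₂ (coprime⇒invertible α∈S))
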